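{- Let $\Pi$, $p$ and the ordered Satake parameters $\alpha_1,\dots,\alpha_{2n}$ be as in the context. If $I=(i_1,\dots,i_n)$ with $1\le i_1<\dots<i_n\le 2n$ is such that $\alpha_I$ is non-critical slope (i.e. $r_I<\#\mathrm{Crit}(\Pi)$), then $\alpha_I$ is of Shalika type, i.e. $I$ contains precisely one element of each pair $\{i,2n+1-i\}$ for $i=1,\dots,n$.
   Context: Let $n\ge1$ and let $\Pi$ be a cuspidal automorphic representation of $\mathrm{GL}_{2n}(\mathbb{A}_{\mathbb{Q}})$ which is cohomological with respect to an integral weight $\mu=(\mu_1,\dots,\mu_{2n})\in\mathbb{Z}^{2n}$, and which is the transfer of a globally generic cuspidal automorphic representation of $\mathrm{GSpin}_{2n+1}(\mathbb{A}_{\mathbb{Q}})$. Then $\mu_1\ge\dots\ge\mu_{2n}$ and there is $w\in\mathbb{Z}$ with $\mu_i+\mu_{2n+1-i}=w$ for $i=1,\dots,n$. Set $\mathrm{Crit}(\Pi)=\{j\in\mathbb{Z}:\mu_n\ge j\ge\mu_{n+1}\}$. Let $p$ be a prime at which $\Pi$ is unramified and set $h_i=\mu_i+2n-i$. There is an unramified character $\lambda_p$ of the diagonal torus $T(\mathbb{Q}_p)$ with $\Pi_p$ isomorphic to the normalised parabolic induction from the upper triangular Borel of $|\cdot|^{(2n-1)/2}\lambda_p$; the Satake parameters are $\alpha_i=\lambda_{p,i}(p)$. Fix $\bar{\mathbb{Q}}_p\cong\mathbb{C}$ and let $v_p$ be the $p$-adic valuation with $v_p(p)=1$. The $\alpha_i$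 are ordered so that $v_p(\alpha_1)\ge\dots\ge v_p(\alpha_{2n})$ and $\alpha_i\alpha_{2n+1-i}=\lambda$ for a fixed $\lambda$ with $v_p(\lambda)=2n-1+w$. It is known (Hida) that $\sum_{i=1}^{j}v_p(\alpha_{2n+1-i})\ge\sum_{i=1}^{j}h_{2n+1-i}$ for $j=1,\dots,2n$, with equality for $j=2n$. For $I=(i_1<\dots<i_n)\subset\{1,\dots,2n\}$ put $\alpha_I=\alpha_{i_1}\cdots\alpha_{i_n}$ and $r_I=v_p(\alpha_I)-\sum_{i=n+1}^{2n}h_i$; $\alpha_I$ is non-critical slope if $r_I<\#\mathrm{Crit}(\Pi)$. -}

module Defs where

open import Data.Nat as ℕ using (ℕ; zero; suc; _∸_)
open import Data.Nat.Properties as ℕP using ()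
open import Data.Integer as ℤ using (ℤ; +_)
open import Data.Fin as Fin using (Fin; toℕ; opposite; fromℕ<)
open import Data.Fin.Subset using (Subset; _∈_; _∉_; ∣_∣)
open import Data.Rational as ℚ using (ℚ; 0ℚ)
open import Data.Bool using (Bool; true; false; if_then_else_)
open import Data.Vec using (lookup)
open import Relation.Nullary using (¬_)
open import Relation.Binary.PropositionalEquality using (_≡_)
open import Data.Product using (_×_)
open import Data.Sum using (_⊎_)

ℤ→ℚ : ℤ → ℚ
ℤ→ℚ z = z ℚ./ 1

ΣQ : ∀ {m} → (Fin m → ℚ) → ℚ
ΣQ {zero}  f = 0ℚ
ΣQ {suc m} f = f Fin.zero ℚ.+ ΣQ (λ i → f (Fin.suc i))

ΣQ≥ : ∀ {m} → ℕ → (Fin m → ℚ) → ℚ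
ΣQ≥ lo f = ΣQ (λ i → if lo ℕ.≤ᵇ toℕ i then f i else 0ℚ)

ΣQ∈ : ∀ {m} → Subset m → (Fin m → ℚ) → ℚ
ΣQ∈ I f = ΣQ (λ i → if lookup I i then f i else 0ℚ)

-- The paper indexes 1..2n; we use 0-based indices i ∈ Fin (n + n), where the
-- paper's index i corresponds to our i-1.  The paper's pairing i ↦ 2n+1-i
-- becomes  opposite : i ↦ 2n-1-i.

-- the paper's h_i = μ_i + 2n - i; with 0-based index i this is μ i + (2n-1-i)
hwt : (n : ℕ) → (Fin (n ℕ.+ n) → ℤ) → Fin (n ℕ.+ n) → ℤ
hwt n μ i = μ i ℤ.+ (+ ((n ℕ.+ n) ∸ 1 ∸ toℕ i))

-- 0-based positions of the paper's μ_n and μ_{n+1} when n = suc k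
midLo : (k : ℕ) → Fin (suc k ℕ.+ suc k)
midLo k = fromℕ< {k} (ℕP.m≤m+n (suc k) (suc k))

midHi : (k : ℕ) → Fin (suc k ℕ.+ suc k)
midHi k = fromℕ< {suc k} (ℕ.s≤s (ℕP.m≤n+m (suc k) k))

-- #Crit(Π) = #{ j ∈ ℤ : a ≥ j ≥ b } = a - b + 1  (valid when b ≤ a, which
-- holds under the hypothesis that μ is non-increasing)
critCount : ℤ → ℤ → ℤ
critCount a b = a ℤ.- b ℤ.+ + 1

ShalikaType : (n : ℕ) → Subset (n ℕ.+ n) → Set
ShalikaType n I = (i : Fin (n ℕ.+ n)) → toℕ i ℕ.< n →
  ((i ∈ I × opposite i ∉ I) ⊎ (i ∉ I × opposite i ∈ I))

-- Let H be the upper half of the indices (0-based: those ≥ n, where the valuations are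
-- smallest) and write ī for the index opposite to i.  Since |I| = |H| = n, if I is not
-- of Shalika type one finds a ∈ I ∖ H and y ∈ H ∖ I with ā ≠ y: a pair {i, ī} inside I
-- leaves some y ∈ H outside I, a pair outside I leaves some a ∈ I below H.  Exchanging
-- a for y gives Σ_I v ≥ Σ_H v + v_a − v_y, as v is separated by the pivot v_n on H.
-- Now v_a = v(λ) − v_ā, and ā, y are distinct elements of H, so v_ā + v_y ≤ v_n + v_{n+1};
-- hence Σ_I v ≥ v(λ) + Σ_{i ≥ n+2} v ≥ v(λ) + Σ_{i ≥ n+2} h by Hida's inequality.  So
-- r_I ≥ v(λ) − h_n − h_{n+1} = μ_{n-1} − μ_{n+1} + 2 > μ_{n-1} − μ_n + 1 = #Crit(Π),
-- against non-critical slope.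

module Submission where

open import Defs
open import Data.Nat as ℕ using (ℕ; zero; suc; _∸_; z≤n; s≤s)
import Data.Nat.Properties as ℕP
open import Data.Fin as Fin using (Fin; toℕ; opposite)
open import Data.Fin.Subset using (Subset; inside; outside; _∈_; _∉_; _⊆_; ∣_∣)
open import Data.Fin.Subset.Properties using (_∈?_; p⊂q⇒∣p∣<∣q∣)
open import Data.Fin.Properties as FinP using (any?)
open import Data.Rational as ℚ using (ℚ; 0ℚ; _+_; _-_; -_; _≤_; _<_)
import Data.Rational.Properties as ℚP
open import Data.Rational.Solver using (module +-*-Solver)
open +-*-Solver using (solve; _:+_; _:-_; _:=_; con)
open import Data.Rational.Literals using (fromℤ)
import Data.Rational.Unnormalised as ℚᵘ
import Data.Rational.Unnormalised.Properties as ℚᵘP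
open import Data.Integer as ℤ using (ℤ; +_)
import Data.Integer.Properties as ℤP
import Data.Integer.Tactic.RingSolver as ℤ-Solver
open import Algebra.Definitions.RawMonoid ℚ.+-0-rawMonoid using () renaming (_×_ to _·_)
open import Data.Bool using (if_then_else_)
open import Data.Vec.Base using ([]; _∷_; lookup; here; there)
import Data.Vec.Properties as VecP
open import Function using (_∘_)
open import Data.Product using (∃; _×_; _,_)
open import Data.Sum using (inj₁; inj₂)
open import Relation.Nullary using (yes; no; ¬?; contradiction)
open import Relation.Nullary.Decidable using (_×-dec_; decidable-stable)
open import Relation.Binary.PropositionalEquality
open import Relation.Binary.Definitions using (tri<; tri≈; tri>)

0≤p⇒q≤p+q : ∀ {p q} → 0ℚ ≤ p → q ≤ p + q
0≤p⇒q≤p+q {p} {q} 0≤p = subst (_≤ p + q) (ℚP.+-identityˡ q) (ℚP.+-monoˡ-≤ q 0≤p)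

0≤q⇒p≤p+q : ∀ {p q} → 0ℚ ≤ q → p ≤ p + q
0≤q⇒p≤p+q {p} {q} 0≤q = subst (_≤ p + q) (ℚP.+-identityʳ p) (ℚP.+-monoʳ-≤ p 0≤q)

p≤q⇒0≤q-p : ∀ {p q} → p ≤ q → 0ℚ ≤ q - p
p≤q⇒0≤q-p {p} {q} p≤q = subst (_≤ q - p) (ℚP.+-inverseʳ p) (ℚP.+-monoˡ-≤ (- p) p≤q)

p+q-q≡p : ∀ p q → p + q - q ≡ p
p+q-q≡p = solve 2 (λ p q → p :+ q :- q := p) refl

+-cancelʳ-≤ : ∀ {p q} r → p + r ≤ q + r → p ≤ q
+-cancelʳ-≤ {p} {q} r le = subst₂ _≤_ (p+q-q≡p p r) (p+q-q≡p q r) (ℚP.+-monoˡ-≤ (- r) le)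

p+q≤r⇒p≤r-q : ∀ {p q r} → p + q ≤ r → p ≤ r - q
p+q≤r⇒p≤r-q {p} {q} {r} le = subst (_≤ r - q) (p+q-q≡p p q) (ℚP.+-monoˡ-≤ (- q) le)

ΣQ-cong : ∀ {m} {f g : Fin m → ℚ} → (∀ i → f i ≡ g i) → ΣQ f ≡ ΣQ g
ΣQ-cong {zero}  _   = refl
ΣQ-cong {suc m} f≗g = cong₂ _+_ (f≗g Fin.zero) (ΣQ-cong (f≗g ∘ Fin.suc))

ΣQ-distrib-+ : ∀ {m} (f g : Fin m → ℚ) → ΣQ (λ i → f i + g i) ≡ ΣQ f + ΣQ g
ΣQ-distrib-+ {zero}  f g = sym (ℚP.+-identityˡ 0ℚ)
ΣQ-distrib-+ {suc m} f g = begin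
  f₀ + g₀ + ΣQ (λ i → f (Fin.suc i) + g (Fin.suc i))
    ≡⟨ cong (_+_ (f₀ + g₀)) (ΣQ-distrib-+ (f ∘ Fin.suc) (g ∘ Fin.suc)) ⟩
  f₀ + g₀ + (ΣQ (f ∘ Fin.suc) + ΣQ (g ∘ Fin.suc))
    ≡⟨ interchange f₀ g₀ _ _ ⟩
  f₀ + ΣQ (f ∘ Fin.suc) + (g₀ + ΣQ (g ∘ Fin.suc)) ∎
  where
  open ≡-Reasoning
  f₀ g₀ : ℚ
  f₀ = f Fin.zero
  g₀ = g Fin.zero
  interchange : ∀ a b c d → a + b + (c + d) ≡ a + c + (b + d)
  interchange = solve 4 (λ a b c d → a :+ b :+ (c :+ d) := a :+ c :+ (b :+ d)) refl

ΣQ-nonneg : ∀ {m} {f : Fin m → ℚ} → (∀ i → 0ℚ ≤ f i) → 0ℚ ≤ ΣQ f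
ΣQ-nonneg {zero}  _   = ℚP.≤-refl
ΣQ-nonneg {suc m} f≥0 = ℚP.≤-trans (f≥0 Fin.zero) (0≤q⇒p≤p+q (ΣQ-nonneg (f≥0 ∘ Fin.suc)))

term≤ΣQ : ∀ {m} {f : Fin m → ℚ} → (∀ i → 0ℚ ≤ f i) → ∀ a → f a ≤ ΣQ f
term≤ΣQ f≥0 Fin.zero    = 0≤q⇒p≤p+q (ΣQ-nonneg (f≥0 ∘ Fin.suc))
term≤ΣQ f≥0 (Fin.suc a) = ℚP.≤-trans (term≤ΣQ (f≥0 ∘ Fin.suc) a) (0≤p⇒q≤p+q (f≥0 Fin.zero))

pair≤ΣQ : ∀ {m} {f : Fin m → ℚ} → (∀ i → 0ℚ ≤ f i) →
          ∀ {a b} → a ≢ b → f a + f b ≤ ΣQ f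
pair≤ΣQ f≥0 {Fin.zero}  {Fin.zero}  a≢b = contradiction refl a≢b
pair≤ΣQ {f = f} f≥0 {Fin.zero} {Fin.suc b} _ =
  ℚP.+-monoʳ-≤ (f Fin.zero) (term≤ΣQ (f≥0 ∘ Fin.suc) b)
pair≤ΣQ {f = f} f≥0 {Fin.suc a} {Fin.zero} _ =
  subst (_≤ ΣQ f) (ℚP.+-comm (f Fin.zero) (f (Fin.suc a)))
        (ℚP.+-monoʳ-≤ (f Fin.zero) (term≤ΣQ (f≥0 ∘ Fin.suc) a))
pair≤ΣQ f≥0 {Fin.suc a} {Fin.suc b} a≢b =
  ℚP.≤-trans (pair≤ΣQ (f≥0 ∘ Fin.suc) (a≢b ∘ cong Fin.suc)) (0≤p⇒q≤p+q (f≥0 Fin.zero))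

select : ∀ {m} → Subset m → (Fin m → ℚ) → Fin m → ℚ
select p f i = if lookup p i then f i else 0ℚ

ΣQ∈-const : ∀ {m} (p : Subset m) t → ΣQ∈ p (λ _ → t) ≡ ∣ p ∣ · t
ΣQ∈-const []            t = refl
ΣQ∈-const (inside ∷ p)  t = cong (_+_ t) (ΣQ∈-const p t)
ΣQ∈-const (outside ∷ p) t = trans (ℚP.+-identityˡ _) (ΣQ∈-const p t)

∃-∈-∉-of-equal-size : ∀ {m} {p q : Subset m} {x} →
                      ∣ p ∣ ≡ ∣ q ∣ → x ∈ p → x ∉ q → ∃ λ y → y ∈ q × y ∉ p
∃-∈-∉-of-equal-size {p = p} {q} {x} ∣p∣≡∣q∣ x∈p x∉q
  with any? (λ y → y ∈? q ×-dec ¬? (y ∈? p))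
... | yes q∖p-inhabited = q∖p-inhabited
... | no  q∖p-empty     =
  contradiction (p⊂q⇒∣p∣<∣q∣ (q⊆p , x , x∈p , x∉q)) (ℕP.<-irrefl (sym ∣p∣≡∣q∣))
  where
  q⊆p : q ⊆ p
  q⊆p {y} y∈q = decidable-stable (y ∈? p) (λ y∉p → q∖p-empty (y , y∈q , y∉p))

lookup≡outside⇒∉ : ∀ {m} {p : Subset m} {x} → lookup p x ≡ outside → x ∉ p
lookup≡outside⇒∉ px≡outside x∈p with () ← trans (sym (VecP.[]=⇒lookup x∈p)) px≡outside

∉⇒lookup≡outside : ∀ {m} {p : Subset m} {x} → x ∉ p → lookup p x ≡ outside
∉⇒lookup≡outside {p = p} {x} x∉p with lookup p x in eq
... | inside  = contradiction (VecP.lookup⇒[]= x p eq) x∉p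
... | outside = refl

atLeast : ∀ {m} → ℕ → Subset m
atLeast {zero}  _        = []
atLeast {suc m} zero     = inside ∷ atLeast zero
atLeast {suc m} (suc lo) = outside ∷ atLeast lo

atLeast⁺ : ∀ {m lo} {i : Fin m} → lo ℕ.≤ toℕ i → i ∈ atLeast lo
atLeast⁺ {lo = zero}   {Fin.zero}  _           = here
atLeast⁺ {lo = zero}   {Fin.suc i} _           = there (atLeast⁺ z≤n)
atLeast⁺ {lo = suc lo} {Fin.suc i} (s≤s lo≤i) = there (atLeast⁺ lo≤i)

atLeast⁻ : ∀ {m lo} {i : Fin m} → i ∈ atLeast lo → lo ℕ.≤ toℕ i
atLeast⁻ {lo = zero}                _          = z≤n
atLeast⁻ {lo = suc lo} {Fin.suc i} (there i∈) = s≤s (atLeast⁻ i∈)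

∣atLeast∣ : ∀ m lo → ∣ atLeast {m} lo ∣ ≡ m ∸ lo
∣atLeast∣ zero    zero     = refl
∣atLeast∣ zero    (suc lo) = refl
∣atLeast∣ (suc m) zero     = cong suc (∣atLeast∣ m zero)
∣atLeast∣ (suc m) (suc lo) = ∣atLeast∣ m lo

<ᵇ-suc : ∀ l x → (l ℕ.<ᵇ suc x) ≡ (l ℕ.≤ᵇ x)
<ᵇ-suc zero    x = refl
<ᵇ-suc (suc l) x = refl

ΣQ≥-suc : ∀ {m} lo (f : Fin (suc m) → ℚ) → ΣQ≥ (suc lo) f ≡ ΣQ≥ lo (f ∘ Fin.suc)
ΣQ≥-suc lo f = trans (ℚP.+-identityˡ _)
  (ΣQ-cong λ i → cong (λ b → if b then f (Fin.suc i) else 0ℚ) (<ᵇ-suc lo (toℕ i)))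

ΣQ≥-beyond : ∀ {m lo} (f : Fin m → ℚ) → m ℕ.≤ lo → ΣQ≥ lo f ≡ 0ℚ
ΣQ≥-beyond {zero}           f _          = refl
ΣQ≥-beyond {suc m} {suc lo} f (s≤s m≤lo) =
  trans (ΣQ≥-suc lo f) (ΣQ≥-beyond (f ∘ Fin.suc) m≤lo)

ΣQ≥-split : ∀ {m lo} (f : Fin m → ℚ) (p : Fin m) → toℕ p ≡ lo →
            ΣQ≥ lo f ≡ f p + ΣQ≥ (suc lo) f
ΣQ≥-split f Fin.zero    refl = cong (_+_ (f Fin.zero)) (sym (ΣQ≥-suc 0 f))
ΣQ≥-split f (Fin.suc p) refl = begin
  ΣQ≥ (suc (toℕ p)) f
    ≡⟨ ΣQ≥-suc (toℕ p) f ⟩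
  ΣQ≥ (toℕ p) (f ∘ Fin.suc)
    ≡⟨ ΣQ≥-split (f ∘ Fin.suc) p refl ⟩
  f (Fin.suc p) + ΣQ≥ (suc (toℕ p)) (f ∘ Fin.suc)
    ≡⟨ cong (_+_ (f (Fin.suc p))) (ΣQ≥-suc (suc (toℕ p)) f) ⟨
  f (Fin.suc p) + ΣQ≥ (suc (suc (toℕ p))) f
    ∎
  where open ≡-Reasoning

ΣQ≥≡ΣQ∈atLeast : ∀ {m} lo (f : Fin m → ℚ) → ΣQ≥ lo f ≡ ΣQ∈ (atLeast lo) f
ΣQ≥≡ΣQ∈atLeast {zero}  _        _ = refl
ΣQ≥≡ΣQ∈atLeast {suc m} zero     f = cong (_+_ (f Fin.zero)) (ΣQ≥≡ΣQ∈atLeast zero (f ∘ Fin.suc))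
ΣQ≥≡ΣQ∈atLeast {suc m} (suc lo) f = trans (ΣQ≥-suc lo f)
  (trans (ΣQ≥≡ΣQ∈atLeast lo (f ∘ Fin.suc)) (sym (ℚP.+-identityˡ _)))

ΣQ≥-≤-everywhere : ∀ {m} {f g : Fin m → ℚ} →
  (∀ j → 1 ℕ.≤ j → j ℕ.≤ m → ΣQ≥ (m ∸ j) f ≤ ΣQ≥ (m ∸ j) g) →
  ∀ lo → ΣQ≥ lo f ≤ ΣQ≥ lo g
ΣQ≥-≤-everywhere {m} {f} {g} tails lo with lo ℕ.<? m
... | yes lo<m = subst (λ l → ΣQ≥ l f ≤ ΣQ≥ l g) (ℕP.m∸[m∸n]≡n (ℕP.<⇒≤ lo<m))
                       (tails (m ∸ lo) (ℕP.m<n⇒0<n∸m lo<m) (ℕP.m∸n≤m m lo))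
... | no  lo≮m = subst₂ _≤_ (sym (ΣQ≥-beyond f m≤lo)) (sym (ΣQ≥-beyond g m≤lo)) ℚP.≤-refl
  where
  m≤lo : m ℕ.≤ lo
  m≤lo = ℕP.≮⇒≥ lo≮m

-- gap is nonnegative because the pivot t separates v on J from v off J, and
-- Σ_J v + |I| t + Σ gap = Σ_I v + |J| t; keeping only gap a + gap y gives the bound.
exchange : ∀ {m} {I J : Subset m} → ∣ I ∣ ≡ ∣ J ∣ → (v : Fin m → ℚ) (t : ℚ) →
           (∀ i → i ∈ J → v i ≤ t) → (∀ i → i ∉ J → t ≤ v i) →
           ∀ {a y} → a ∈ I → a ∉ J → y ∈ J → y ∉ I →
           ΣQ∈ J v + v a ≤ ΣQ∈ I v + v y
exchange {m} {I} {J} ∣I∣≡∣J∣ v t J-low J-high {a} {y} a∈I a∉J y∈J y∉I =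
  +-cancelʳ-≤ T (begin
    Sⱼ + v a + T                              ≡⟨ regroup Sⱼ (v a) (v y) t T ⟩
    Sⱼ + T + ((v a - t) + (t - v y)) + v y    ≡⟨ cong (λ d → Sⱼ + T + d + v y) (cong₂ _+_ gap-a gap-y) ⟨
    Sⱼ + T + (gap a + gap y) + v y            ≤⟨ ℚP.+-monoˡ-≤ (v y) (ℚP.+-monoʳ-≤ (Sⱼ + T) (pair≤ΣQ gap≥0 a≢y)) ⟩
    Sⱼ + T + ΣQ gap + v y                     ≡⟨ cong (_+ v y) ΣQ-gap ⟩
    Sᵢ + T + v y                              ≡⟨ swap-last Sᵢ T (v y) ⟩
    Sᵢ + v y + T                              ∎)
  where
  open ℚP.≤-Reasoning
  Sᵢ Sⱼ T : ℚ
  Sᵢ = ΣQ∈ I v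
  Sⱼ = ΣQ∈ J v
  T  = ∣ I ∣ · t

  t̲ : Fin m → ℚ
  t̲ _ = t

  gap : Fin m → ℚ
  gap i with lookup I i | lookup J i
  ... | inside  | outside = v i - t
  ... | outside | inside  = t - v i
  ... | _       | _       = 0ℚ

  gap≥0 : ∀ i → 0ℚ ≤ gap i
  gap≥0 i with lookup I i | lookup J i in Ji
  ... | inside  | inside  = ℚP.≤-refl
  ... | inside  | outside = p≤q⇒0≤q-p (J-high i (lookup≡outside⇒∉ Ji))
  ... | outside | inside  = p≤q⇒0≤q-p (J-low i (VecP.lookup⇒[]= i J Ji))
  ... | outside | outside = ℚP.≤-refl

  gap-a : gap a ≡ v a - t
  gap-a rewrite VecP.[]=⇒lookup a∈I | ∉⇒lookup≡outside a∉J = refl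

  gap-y : gap y ≡ t - v y
  gap-y rewrite VecP.[]=⇒lookup y∈J | ∉⇒lookup≡outside y∉I = refl

  a≢y : a ≢ y
  a≢y a≡y = a∉J (subst (_∈ J) (sym a≡y) y∈J)

  balance-out : ∀ x u → 0ℚ + u + (x - u) ≡ x + 0ℚ
  balance-out = solve 2 (λ x u → con 0ℚ :+ u :+ (x :- u) := x :+ con 0ℚ) refl

  balance-in : ∀ x u → x + 0ℚ + (u - x) ≡ 0ℚ + u
  balance-in = solve 2 (λ x u → x :+ con 0ℚ :+ (u :- x) := con 0ℚ :+ u) refl

  gap-balances : ∀ i → select J v i + select I t̲ i + gap i ≡ select I v i + select J t̲ i
  gap-balances i with lookup I i | lookup J i
  ... | inside  | inside  = ℚP.+-identityʳ _
  ... | inside  | outside = balance-out (v i) t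
  ... | outside | inside  = balance-in (v i) t
  ... | outside | outside = ℚP.+-identityʳ _

  ΣQ-gap : Sⱼ + T + ΣQ gap ≡ Sᵢ + T
  ΣQ-gap = begin-equality
    Sⱼ + T + ΣQ gap                                       ≡⟨ cong (λ s → Sⱼ + s + ΣQ gap) (ΣQ∈-const I t) ⟨
    Sⱼ + ΣQ∈ I t̲ + ΣQ gap                                 ≡⟨ cong (_+ ΣQ gap) (ΣQ-distrib-+ (select J v) (select I t̲)) ⟨
    ΣQ (λ i → select J v i + select I t̲ i) + ΣQ gap       ≡⟨ ΣQ-distrib-+ _ gap ⟨
    ΣQ (λ i → select J v i + select I t̲ i + gap i)        ≡⟨ ΣQ-cong gap-balances ⟩
    ΣQ (λ i → select I v i + select J t̲ i)                ≡⟨ ΣQ-distrib-+ (select I v) (select J t̲) ⟩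
    Sᵢ + ΣQ∈ J t̲                                          ≡⟨ cong (_+_ Sᵢ) (ΣQ∈-const J t) ⟩
    Sᵢ + ∣ J ∣ · t                                        ≡⟨ cong (λ c → Sᵢ + c · t) ∣I∣≡∣J∣ ⟨
    Sᵢ + T                                                ∎

  regroup : ∀ s x z u w → s + x + w ≡ s + w + ((x - u) + (u - z)) + z
  regroup = solve 5 (λ s x z u w → s :+ x :+ w := s :+ w :+ ((x :- u) :+ (u :- z)) :+ z) refl

  swap-last : ∀ p q r → p + q + r ≡ p + r + q
  swap-last = solve 3 (λ p q r → p :+ q :+ r := p :+ r :+ q) refl

opposite-injective : ∀ {m} {i j : Fin m} → opposite i ≡ opposite j → i ≡ j
opposite-injective {i = i} {j} eq =
  trans (sym (FinP.opposite-involutive i)) (trans (cong opposite eq) (FinP.opposite-involutive j))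

OnlyOppositeExchanges : (n : ℕ) → Subset (n ℕ.+ n) → Set
OnlyOppositeExchanges n I =
  ∀ {a y} → a ∈ I → a ∉ atLeast n → y ∈ atLeast n → y ∉ I → opposite a ≡ y

module _ {n : ℕ} where

  ∣upperHalf∣ : ∣ atLeast {n ℕ.+ n} n ∣ ≡ n
  ∣upperHalf∣ = trans (∣atLeast∣ (n ℕ.+ n) n) (ℕP.m+n∸m≡n n n)

  lower∉upperHalf : {i : Fin (n ℕ.+ n)} → toℕ i ℕ.< n → i ∉ atLeast n
  lower∉upperHalf i<n i∈H = ℕP.<⇒≱ i<n (atLeast⁻ i∈H)

  ∉upperHalf⇒lower : {i : Fin (n ℕ.+ n)} → i ∉ atLeast n → toℕ i ℕ.< n
  ∉upperHalf⇒lower i∉H = ℕP.≰⇒> (i∉H ∘ atLeast⁺)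

  opposite-lower∈upperHalf : {i : Fin (n ℕ.+ n)} → toℕ i ℕ.< n → opposite i ∈ atLeast n
  opposite-lower∈upperHalf {i} i<n = atLeast⁺ (begin
    n                       ≡⟨ ℕP.m+n∸m≡n n n ⟨
    n ℕ.+ n ∸ n             ≤⟨ ℕP.∸-monoʳ-≤ (n ℕ.+ n) i<n ⟩
    n ℕ.+ n ∸ suc (toℕ i)   ≡⟨ FinP.opposite-prop i ⟨
    toℕ (opposite i)        ∎)
    where open ℕP.≤-Reasoning

  shalikaType : {I : Subset (n ℕ.+ n)} → ∣ I ∣ ≡ n → OnlyOppositeExchanges n I → ShalikaType n I
  shalikaType {I} ∣I∣≡n paired i i<n with i ∈? I | opposite i ∈? I
  ... | yes i∈I | no  ī∉I = inj₁ (i∈I , ī∉I)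
  ... | no  i∉I | yes ī∈I = inj₂ (i∉I , ī∈I)
  ... | yes i∈I | yes ī∈I =
    let y , y∈H , y∉I = ∃-∈-∉-of-equal-size (trans ∣I∣≡n (sym ∣upperHalf∣)) i∈I i∉H
    in  contradiction (subst (_∈ I) (paired i∈I i∉H y∈H y∉I) ī∈I) y∉I
    where
    i∉H : i ∉ atLeast n
    i∉H = lower∉upperHalf i<n
  ... | no  i∉I | no  ī∉I =
    let a , a∈I , a∉H = ∃-∈-∉-of-equal-size (trans ∣upperHalf∣ (sym ∣I∣≡n)) ī∈H ī∉I
    in  contradiction (subst (_∈ I) (opposite-injective (paired a∈I a∉H ī∈H ī∉I)) a∈I) i∉I
    where
    ī∈H : opposite i ∈ atLeast n
    ī∈H = opposite-lower∈upperHalf i<n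

onlyOppositeExchanges-1 : (I : Subset 2) → OnlyOppositeExchanges 1 I
onlyOppositeExchanges-1 I {Fin.zero}        {Fin.suc Fin.zero} _ _   _  _ = refl
onlyOppositeExchanges-1 I {Fin.suc Fin.zero}                    _ a∉H _  _ = contradiction (there here) a∉H
onlyOppositeExchanges-1 I {Fin.zero}        {Fin.zero}         _ _   () _

module _ {m} {v : Fin m → ℚ} (v-anti : ∀ i j → toℕ i ℕ.≤ toℕ j → v j ≤ v i) {p q : Fin m}
         (q≡1+p : toℕ q ≡ suc (toℕ p)) where

  +-≤-two-largest-< : ∀ {x y} → toℕ p ℕ.≤ toℕ x → toℕ x ℕ.< toℕ y →
                      v x + v y ≤ v p + v q
  +-≤-two-largest-< {y = y} p≤x x<y = ℚP.+-mono-≤ (v-anti p _ p≤x)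
    (v-anti q y (subst (ℕ._≤ toℕ y) (sym q≡1+p) (ℕP.≤-trans (s≤s p≤x) x<y)))

  +-≤-two-largest : ∀ {x y} → toℕ p ℕ.≤ toℕ x → toℕ p ℕ.≤ toℕ y → x ≢ y →
                    v x + v y ≤ v p + v q
  +-≤-two-largest {x} {y} p≤x p≤y x≢y with ℕP.<-cmp (toℕ x) (toℕ y)
  ... | tri< x<y _   _   = +-≤-two-largest-< p≤x x<y
  ... | tri≈ _   x≡y _   = contradiction (FinP.toℕ-injective x≡y) x≢y
  ... | tri> _   _   y<x = subst (_≤ v p + v q) (ℚP.+-comm (v y) (v x)) (+-≤-two-largest-< p≤y y<x)

ℤ→ℚ≡fromℤ : ∀ z → ℤ→ℚ z ≡ fromℤ z
ℤ→ℚ≡fromℤ z = ℚP.↥p/↧p≡p (fromℤ z)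

ℤ→ℚ-+ : ∀ a b → ℤ→ℚ (a ℤ.+ b) ≡ ℤ→ℚ a + ℤ→ℚ b
ℤ→ℚ-+ a b rewrite ℤ→ℚ≡fromℤ (a ℤ.+ b) | ℤ→ℚ≡fromℤ a | ℤ→ℚ≡fromℤ b =
  ℚP.toℚᵘ-injective
    (ℚᵘP.≃-sym (ℚᵘP.≃-trans (ℚP.toℚᵘ-homo-+ (fromℤ a) (fromℤ b)) (ℚᵘ.*≡* (clear a b))))
  where
  clear : ∀ x y → (x ℤ.* + 1 ℤ.+ y ℤ.* + 1) ℤ.* + 1 ≡ (x ℤ.+ y) ℤ.* (+ 1 ℤ.* + 1)
  clear = ℤ-Solver.solve-∀

ℤ→ℚ-mono-≤ : ∀ {a b} → a ℤ.≤ b → ℤ→ℚ a ≤ ℤ→ℚ b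
ℤ→ℚ-mono-≤ {a} {b} a≤b rewrite ℤ→ℚ≡fromℤ a | ℤ→ℚ≡fromℤ b =
  ℚ.*≤* (ℤP.*-monoʳ-≤-nonNeg (+ 1) a≤b)

-- Shaped for use at κ = + k, where + (suc k) and + (N ∸ 1) match both sides by conversion.
critCount-bound : ∀ a b c κ → c ℤ.≤ b →
  critCount a b ℤ.+ ((b ℤ.+ (+ 1 ℤ.+ κ)) ℤ.+ (c ℤ.+ κ))
    ℤ.≤ (+ 1 ℤ.+ κ) ℤ.+ (+ 2 ℤ.+ κ) ℤ.+ (a ℤ.+ b)
critCount-bound a b c κ c≤b = begin
  critCount a b ℤ.+ ((b ℤ.+ (+ 1 ℤ.+ κ)) ℤ.+ (c ℤ.+ κ)) ≡⟨ collect a b c κ ⟩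
  a ℤ.+ (+ 2 ℤ.+ κ ℤ.+ κ) ℤ.+ c                     ≤⟨ ℤP.+-monoʳ-≤ (a ℤ.+ (+ 2 ℤ.+ κ ℤ.+ κ)) c≤b ⟩
  a ℤ.+ (+ 2 ℤ.+ κ ℤ.+ κ) ℤ.+ b                     ≤⟨ ℤP.i≤i+j _ (+ 1) ⟩
  a ℤ.+ (+ 2 ℤ.+ κ ℤ.+ κ) ℤ.+ b ℤ.+ + 1             ≡⟨ spread a b κ ⟩
  (+ 1 ℤ.+ κ) ℤ.+ (+ 2 ℤ.+ κ) ℤ.+ (a ℤ.+ b)         ∎
  where
  open ℤP.≤-Reasoning
  collect : ∀ a b c κ → a ℤ.- b ℤ.+ + 1 ℤ.+ ((b ℤ.+ (+ 1 ℤ.+ κ)) ℤ.+ (c ℤ.+ κ))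
                      ≡ a ℤ.+ (+ 2 ℤ.+ κ ℤ.+ κ) ℤ.+ c
  collect = ℤ-Solver.solve-∀
  spread : ∀ a b κ → a ℤ.+ (+ 2 ℤ.+ κ ℤ.+ κ) ℤ.+ b ℤ.+ + 1
                   ≡ (+ 1 ℤ.+ κ) ℤ.+ (+ 2 ℤ.+ κ) ℤ.+ (a ℤ.+ b)
  spread = ℤ-Solver.solve-∀

hwt-≡ : ∀ n μ (i : Fin (n ℕ.+ n)) j → toℕ i ℕ.+ j ≡ n ℕ.+ n ∸ 1 → hwt n μ i ≡ μ i ℤ.+ + j
hwt-≡ n μ i j i+j≡N-1 =
  cong (λ d → μ i ℤ.+ + d) (trans (cong (_∸ toℕ i) (sym i+j≡N-1)) (ℕP.m+n∸m≡n (toℕ i) j))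

module _ (k : ℕ) where

  private
    n N : ℕ
    n = suc (suc k)
    N = n ℕ.+ n

    next<N : suc n ℕ.< N
    next<N = s≤s (s≤s (ℕP.m≤n+m n k))

    lo hi next : Fin N
    lo   = midLo (suc k)
    hi   = midHi (suc k)
    next = Fin.fromℕ< next<N

    toℕ-lo : toℕ lo ≡ suc k
    toℕ-lo = FinP.toℕ-fromℕ< (ℕP.m≤m+n n n)

    toℕ-hi : toℕ hi ≡ n
    toℕ-hi = FinP.toℕ-fromℕ< (s≤s (ℕP.m≤n+m n (suc k)))

    toℕ-next : toℕ next ≡ suc n
    toℕ-next = FinP.toℕ-fromℕ< next<N

    opposite-lo : opposite lo ≡ hi
    opposite-lo = FinP.toℕ-injective (begin
      toℕ (opposite lo)     ≡⟨ FinP.opposite-prop lo ⟩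
      N ∸ suc (toℕ lo)      ≡⟨ cong (λ i → N ∸ suc i) toℕ-lo ⟩
      N ∸ n                 ≡⟨ ℕP.m+n∸m≡n n n ⟩
      n                     ≡⟨ toℕ-hi ⟨
      toℕ hi                ∎)
      where open ≡-Reasoning

    ΣQ≥-split₂ : (f : Fin N → ℚ) → ΣQ≥ n f ≡ f hi + (f next + ΣQ≥ (suc (suc n)) f)
    ΣQ≥-split₂ f = trans (ΣQ≥-split f hi toℕ-hi) (cong (_+_ (f hi)) (ΣQ≥-split f next toℕ-next))

  exchange-bound : {v : Fin N → ℚ} {c : ℚ} {I : Subset N} →
    (∀ i j → toℕ i ℕ.≤ toℕ j → v j ≤ v i) → (∀ i → v i + v (opposite i) ≡ c) → ∣ I ∣ ≡ n →
    ∀ {a y} → a ∈ I → a ∉ atLeast n → y ∈ atLeast n → y ∉ I → opposite a ≢ y →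
    c + ΣQ≥ (suc (suc n)) v ≤ ΣQ∈ I v
  exchange-bound {v} {c} {I} v-anti v-pair ∣I∣≡n {a} {y} a∈I a∉H y∈H y∉I x≢y =
    +-cancelʳ-≤ (v y) (begin
      c + S + v y                  ≡⟨ cong (λ z → z + S + v y) (v-pair a) ⟨
      v a + v x + S + v y          ≡⟨ pull-pair (v a) (v x) S (v y) ⟩
      v a + (v x + v y) + S        ≤⟨ ℚP.+-monoˡ-≤ S (ℚP.+-monoʳ-≤ (v a) top-two) ⟩
      v a + (v hi + v next) + S    ≡⟨ push-pair (v a) (v hi) (v next) S ⟩
      v hi + (v next + S) + v a    ≡⟨ cong (_+ v a) (ΣQ≥-split₂ v) ⟨
      ΣQ≥ n v + v a                ≡⟨ cong (_+ v a) (ΣQ≥≡ΣQ∈atLeast n v) ⟩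
      ΣQ∈ (atLeast n) v + v a      ≤⟨ exchange ∣I∣≡∣H∣ v (v hi) H-low H-high a∈I a∉H y∈H y∉I ⟩
      ΣQ∈ I v + v y                ∎)
    where
    open ℚP.≤-Reasoning
    x : Fin N
    x = opposite a
    S : ℚ
    S = ΣQ≥ (suc (suc n)) v

    ∣I∣≡∣H∣ : ∣ I ∣ ≡ ∣ atLeast {N} n ∣
    ∣I∣≡∣H∣ = trans ∣I∣≡n (sym (∣upperHalf∣ {n}))

    hi≤ : ∀ {i} → i ∈ atLeast n → toℕ hi ℕ.≤ toℕ i
    hi≤ {i} i∈H = subst (ℕ._≤ toℕ i) (sym toℕ-hi) (atLeast⁻ i∈H)

    H-low : ∀ i → i ∈ atLeast n → v i ≤ v hi
    H-low i i∈H = v-anti hi i (hi≤ i∈H)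

    H-high : ∀ i → i ∉ atLeast n → v hi ≤ v i
    H-high i i∉H =
      v-anti i hi (subst (toℕ i ℕ.≤_) (sym toℕ-hi) (ℕP.<⇒≤ (∉upperHalf⇒lower {n} i∉H)))

    top-two : v x + v y ≤ v hi + v next
    top-two = +-≤-two-largest v-anti (trans toℕ-next (cong suc (sym toℕ-hi)))
      (hi≤ (opposite-lower∈upperHalf (∉upperHalf⇒lower {n} a∉H))) (hi≤ y∈H) x≢y

    pull-pair : ∀ p q r s → p + q + r + s ≡ p + (q + s) + r
    pull-pair = solve 4 (λ p q r s → p :+ q :+ r :+ s := p :+ (q :+ s) :+ r) refl

    push-pair : ∀ p q r s → p + (q + r) + s ≡ q + (r + s) + p
    push-pair = solve 4 (λ p q r s → p :+ (q :+ r) :+ s := q :+ (r :+ s) :+ p) refl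

  crit-bound : {μ : Fin N → ℤ} {w : ℤ} →
    (∀ i j → toℕ i ℕ.≤ toℕ j → μ j ℤ.≤ μ i) →
    (∀ i → toℕ i ℕ.< n → μ i ℤ.+ μ (opposite i) ≡ w) →
    ℤ→ℚ (critCount (μ lo) (μ hi)) + (ℤ→ℚ (hwt n μ hi) + ℤ→ℚ (hwt n μ next))
      ≤ ℤ→ℚ (+ (N ∸ 1) ℤ.+ w)
  crit-bound {μ} {w} μ-anti μ-pair = subst (_≤ ℤ→ℚ (+ (N ∸ 1) ℤ.+ w)) embed (ℤ→ℚ-mono-≤ (begin
    crit ℤ.+ (hwt n μ hi ℤ.+ hwt n μ next)               ≡⟨ cong (ℤ._+_ crit) (cong₂ ℤ._+_ hwt-hi hwt-next) ⟩
    crit ℤ.+ ((μ hi ℤ.+ + suc k) ℤ.+ (μ next ℤ.+ + k))   ≤⟨ critCount-bound (μ lo) (μ hi) (μ next) (+ k) μ-next≤μ-hi ⟩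
    + (N ∸ 1) ℤ.+ (μ lo ℤ.+ μ hi)                        ≡⟨ cong (ℤ._+_ (+ (N ∸ 1))) w≡ ⟩
    + (N ∸ 1) ℤ.+ w                                      ∎))
    where
    open ℤP.≤-Reasoning
    crit : ℤ
    crit = critCount (μ lo) (μ hi)

    embed : ℤ→ℚ (crit ℤ.+ (hwt n μ hi ℤ.+ hwt n μ next))
          ≡ ℤ→ℚ crit + (ℤ→ℚ (hwt n μ hi) + ℤ→ℚ (hwt n μ next))
    embed = trans (ℤ→ℚ-+ crit _) (cong (_+_ (ℤ→ℚ crit)) (ℤ→ℚ-+ (hwt n μ hi) (hwt n μ next)))

    μ-next≤μ-hi : μ next ℤ.≤ μ hi
    μ-next≤μ-hi = μ-anti hi next (subst₂ ℕ._≤_ (sym toℕ-hi) (sym toℕ-next) (ℕP.n≤1+n n))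

    hwt-hi : hwt n μ hi ≡ μ hi ℤ.+ + suc k
    hwt-hi = hwt-≡ n μ hi (suc k) (trans (cong (ℕ._+ suc k) toℕ-hi) (ℕP.+-comm n (suc k)))

    hwt-next : hwt n μ next ≡ μ next ℤ.+ + k
    hwt-next = hwt-≡ n μ next k
      (trans (cong (ℕ._+ k) toℕ-next) (trans (ℕP.+-comm (suc n) k) (ℕP.+-suc k n)))

    w≡ : μ lo ℤ.+ μ hi ≡ w
    w≡ = trans (cong (λ i → μ lo ℤ.+ μ i) (sym opposite-lo))
               (μ-pair lo (subst (ℕ._< n) (sym toℕ-lo) ℕP.≤-refl))

  noncritical⇒onlyOppositeExchanges :
    (μ : Fin N → ℤ) (w : ℤ) (v : Fin N → ℚ) (I : Subset N) →
    (∀ (i j : Fin N) → toℕ i ℕ.≤ toℕ j → μ j ℤ.≤ μ i) →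
    (∀ (i : Fin N) → toℕ i ℕ.< n → μ i ℤ.+ μ (opposite i) ≡ w) →
    (∀ (i j : Fin N) → toℕ i ℕ.≤ toℕ j → v j ≤ v i) →
    (∀ (i : Fin N) → v i + v (opposite i) ≡ ℤ→ℚ (+ (N ∸ 1) ℤ.+ w)) →
    (∀ (j : ℕ) → 1 ℕ.≤ j → j ℕ.≤ N →
       ΣQ≥ (N ∸ j) (λ i → ℤ→ℚ (hwt n μ i)) ≤ ΣQ≥ (N ∸ j) v) →
    ∣ I ∣ ≡ n →
    (ΣQ∈ I v - ΣQ≥ n (λ i → ℤ→ℚ (hwt n μ i)) < ℤ→ℚ (critCount (μ lo) (μ hi))) →
    OnlyOppositeExchanges n I
  noncritical⇒onlyOppositeExchanges μ w v I μ-anti μ-pair v-anti v-pair hida ∣I∣≡n noncrit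
    {a} {y} a∈I a∉H y∈H y∉I = decidable-stable (opposite a FinP.≟ y) λ x≢y →
      ℚP.<-irrefl refl (ℚP.<-≤-trans noncrit (p+q≤r⇒p≤r-q (begin
        crit + ΣQ≥ n h                          ≡⟨ cong (_+_ crit) (ΣQ≥-split₂ h) ⟩
        crit + (h hi + (h next + T))            ≡⟨ reassoc crit (h hi) (h next) T ⟩
        crit + (h hi + h next) + T              ≤⟨ ℚP.+-mono-≤ (crit-bound μ-anti μ-pair) hida-tail ⟩
        ℤ→ℚ (+ (N ∸ 1) ℤ.+ w) + ΣQ≥ (suc (suc n)) v
                                                ≤⟨ exchange-bound v-anti v-pair ∣I∣≡n a∈I a∉H y∈H y∉I x≢y ⟩
        ΣQ∈ I v                                 ∎)))
    where
    open ℚP.≤-Reasoning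
    h : Fin N → ℚ
    h i = ℤ→ℚ (hwt n μ i)
    crit T : ℚ
    crit = ℤ→ℚ (critCount (μ lo) (μ hi))
    T    = ΣQ≥ (suc (suc n)) h

    hida-tail : T ≤ ΣQ≥ (suc (suc n)) v
    hida-tail = ΣQ≥-≤-everywhere {f = h} {v} hida (suc (suc n))

    reassoc : ∀ p q r s → p + (q + (r + s)) ≡ p + (q + r) + s
    reassoc = solve 4 (λ p q r s → p :+ (q :+ (r :+ s)) := p :+ (q :+ r) :+ s) refl

mainTheorem2 :
    (k : ℕ) → let n = suc k in let N = n ℕ.+ n in
    (μ : Fin N → ℤ) (w : ℤ) (v : Fin N → ℚ) (I : Subset N) →
    -- μ is a dominant weight: μ_1 ≥ … ≥ μ_{2n}
    (∀ (i j : Fin N) → toℕ i ℕ.≤ toℕ j → μ j ℤ.≤ μ i) →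
    -- μ_i + μ_{2n+1-i} = w for i = 1..n
    (∀ (i : Fin N) → toℕ i ℕ.< n → μ i ℤ.+ μ (opposite i) ≡ w) →
    -- v i = v_p(α_i), ordered: v_p(α_1) ≥ … ≥ v_p(α_{2n})
    (∀ (i j : Fin N) → toℕ i ℕ.≤ toℕ j → v j ℚ.≤ v i) →
    -- α_i α_{2n+1-i} = λ with v_p(λ) = 2n-1+w
    (∀ (i : Fin N) → v i ℚ.+ v (opposite i) ≡ ℤ→ℚ (+ (N ∸ 1) ℤ.+ w)) →
    -- Hida: Σ_{i=1}^{j} v_p(α_{2n+1-i}) ≥ Σ_{i=1}^{j} h_{2n+1-i}, j = 1..2n
    (∀ (j : ℕ) → 1 ℕ.≤ j → j ℕ.≤ N →
       ΣQ≥ (N ∸ j) (λ i → ℤ→ℚ (hwt n μ i)) ℚ.≤ ΣQ≥ (N ∸ j) v) →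
    -- … with equality for j = 2n
    ΣQ v ≡ ΣQ (λ i → ℤ→ℚ (hwt n μ i)) →
    -- I has n elements
    ∣ I ∣ ≡ n →
    -- α_I is non-critical slope: r_I < #Crit(Π)
    (ΣQ∈ I v ℚ.- ΣQ≥ n (λ i → ℤ→ℚ (hwt n μ i))
       ℚ.< ℤ→ℚ (critCount (μ (midLo k)) (μ (midHi k)))) →
    ShalikaType n I
mainTheorem2 zero    μ w v I _ _ _ _ _ _ ∣I∣≡1 _ = shalikaType ∣I∣≡1 (onlyOppositeExchanges-1 I)
mainTheorem2 (suc k) μ w v I μ-anti μ-pair v-anti v-pair hida _ ∣I∣≡n noncrit =
  shalikaType ∣I∣≡n
    (noncritical⇒onlyOppositeExchanges k μ w v I μ-anti μ-pair v-anti v-pair hida ∣I∣≡n noncrit)
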